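{- Let $X$ be a $(95,40,12,20)$ strongly regular graph and let $K$ be a $4$-clique of $X$ that is not contained in any $5$-clique of $X$. For $i\in\{0,1,2,3\}$ let $X_i$ be the set of vertices of $V(X)\setminus V(K)$ having exactly $i$ neighbours in $K$, and suppose $(|X_0|,|X_1|,|X_2|,|X_3|)=(0,37,51,3)$. Then every vertex of $X_3$ has exactly $27$ neighbours in $X_1$ and exactly $10$ neighbours in $X_2$.
   Context: A $k$-regular graph $G$ on $v$ vertices is a $(v,k,\lambda,\mu)$ strongly regular graph if any two distinct adjacent vertices have exactly $\lambda$ common neighbours and any two distinct non-adjacent vertices have exactly $\mu$ common neighbours. -}

module Defs where

open import Data.Nat using (ℕ)
open import Data.Fin using (Fin)
open import Data.List using (length; filter; allFin)
open import Data.Product using (_×_; Σ; ∃; ∃-syntax)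
open import Relation.Nullary using (¬_; Dec)
open import Relation.Unary using (Pred; Decidable)
open import Relation.Binary.PropositionalEquality using (_≡_; _≢_)
open import Function.Definitions using (Injective)
open import Level using (0ℓ)

count : ∀ {n} (P : Pred (Fin n) 0ℓ) → Decidable P → ℕ
count {n} P P? = length (filter P? (allFin n))

record Graph (n : ℕ) : Set₁ where
  field
    Adj    : Fin n → Fin n → Set
    adj?   : ∀ u v → Dec (Adj u v)
    sym    : ∀ {u v} → Adj u v → Adj v u
    irrefl : ∀ {u} → ¬ Adj u u

module _ {n : ℕ} (G : Graph n) where
  open Graph G
  open import Relation.Nullary using (_×-dec_)

  nbrsIn : (v : Fin n) (S : Pred (Fin n) 0ℓ) → Decidable S → ℕ
  nbrsIn v S S? = count (λ w → Adj v w × S w) (λ w → adj? v w ×-dec S? w)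

  degree : Fin n → ℕ
  degree v = count (Adj v) (adj? v)

  commonNbrs : Fin n → Fin n → ℕ
  commonNbrs u v = count (λ w → Adj u w × Adj v w) (λ w → adj? u w ×-dec adj? v w)

  record IsSRG (k λ' μ : ℕ) : Set where
    field
      regular   : ∀ v → degree v ≡ k
      adjacent  : ∀ u v → u ≢ v → Adj u v → commonNbrs u v ≡ λ'
      nonadjacent : ∀ u v → u ≢ v → ¬ Adj u v → commonNbrs u v ≡ μ

  IsClique : ∀ {m} → (Fin m → Fin n) → Set
  IsClique {m} f = Injective _≡_ _≡_ f × (∀ i j → i ≢ j → Adj (f i) (f j))

  _⊆ᶜ_ : ∀ {m l} → (Fin m → Fin n) → (Fin l → Fin n) → Set
  K ⊆ᶜ L = ∀ i → ∃[ j ] L j ≡ K i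

  InK : ∀ {m} → (Fin m → Fin n) → Pred (Fin n) 0ℓ
  InK K x = ∃[ i ] K i ≡ x

  nbrsInK : ∀ {m} → (Fin m → Fin n) → Fin n → ℕ
  nbrsInK K x = count (λ i → Adj x (K i)) (λ i → adj? x (K i))

  Xi : ∀ {m} → (Fin m → Fin n) → ℕ → Pred (Fin n) 0ℓ
  Xi K i x = ¬ InK K x × nbrsInK K x ≡ i

  Xi? : ∀ {m} (K : Fin m → Fin n) (i : ℕ) → Decidable (Xi K i)
  Xi? {m} K i x = ¬? (any? (λ j → K j Data.Fin.≟ x)) ×-dec (nbrsInK K x Data.Nat.≟ i)
    where
    open import Relation.Nullary using (¬?)
    open import Data.Fin.Properties using (any?)
    import Data.Fin
    import Data.Nat

-- Write N i for the number of neighbours of x ∈ X₃ in X i. Of the 40 neighbours of x,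
-- 3 lie in K; and the pairs (w, k) with k ∈ K and w adjacent to both x and k number
-- 3λ + μ = 56, of which 9 have w ∈ K. Hence Σ N i = 37 and Σ i · N i = 47 over i ≤ 4.
-- X₀ is empty by hypothesis and X₄ because K is maximal, so it remains to see that X₃
-- is independent. If x, y ∈ X₃ were adjacent, the number t w of neighbours of w in the
-- 6-set K ∪ {x, y} would satisfy Σ t = 6k = 240 and Σ t² = 632 (the common neighbours
-- of all ordered pairs from the 6-set), so Σ (t − 2)(t − 3) = 2; but w = x and w = y
-- alone contribute 2 each. Finally N 1 + N 2 = 37 and N 1 + 2 · N 2 = 47.

module Submission where

open import Defs
open import Data.Fin using (Fin)
open import Data.Product using (_×_; ∃-syntax)
open import Relation.Nullary using (¬_)
open import Relation.Binary.PropositionalEquality using (_≡_)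

open import Data.Nat.Properties
open import Algebra.Properties.CommutativeSemigroup *-commutativeSemigroup using (x∙yz≈y∙xz; xy∙z≈xz∙y)
open import Algebra.Properties.Semiring.Sum +-*-semiring
  using (sum; sum-syntax; ∑-distrib-+; ∑-comm; *-distribˡ-sum; *-distribʳ-sum; sum-cong-≗; sum-remove)
open import Data.Bool.Base using (true; false; if_then_else_)
open import Data.Empty using (⊥-elim)
open import Data.Fin.Base using (zero; suc; toℕ; punchIn)
open import Data.Fin.Properties using (any?) renaming (_≟_ to _≟ᶠ_)
open import Data.List.Base using (length; filter; tabulate)
open import Data.List.Properties using (filter-none)
open import Data.List.Relation.Unary.All.Properties using (tabulate⁺)
open import Data.Nat.Base using (ℕ; zero; suc; _+_; _*_; _≤_; _<_; z≤n; s≤s)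
open import Data.Nat.Tactic.RingSolver using (solve-∀)
open import Data.Product using (_,_; proj₁; proj₂)
import Data.Vec.Functional as Vector
open import Function.Base using (_∘_; id)
open import Function.Bundles using (_⇔_; mk⇔)
open import Function.Definitions using (Injective)
open import Level using (Level; 0ℓ)
open import Relation.Nullary using (Dec; does; yes; no; ¬?; _×-dec_)
open import Relation.Nullary.Decidable using (does-⇔; dec-true; dec-false)
open import Relation.Unary using (Pred; Decidable)
open import Relation.Binary.PropositionalEquality
  using (refl; sym; trans; cong; cong₂; subst; subst₂; _≢_; module ≡-Reasoning)

private variable
  a : Level
  A B : Set a
  m n : ℕ

-- Indicators and finite sums

𝟙 : Dec A → ℕ
𝟙 d = if does d then 1 else 0

𝟙-cong : A ⇔ B → (a? : Dec A) (b? : Dec B) → 𝟙 a? ≡ 𝟙 b?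
𝟙-cong A⇔B a? b? = cong (λ b → if b then 1 else 0) (does-⇔ A⇔B a? b?)

𝟙-yes : (a? : Dec A) → A → 𝟙 a? ≡ 1
𝟙-yes a? a = cong (λ b → if b then 1 else 0) (dec-true a? a)

𝟙-no : (a? : Dec A) → ¬ A → 𝟙 a? ≡ 0
𝟙-no a? ¬a = cong (λ b → if b then 1 else 0) (dec-false a? ¬a)

𝟙-× : (a? : Dec A) (b? : Dec B) → 𝟙 (a? ×-dec b?) ≡ 𝟙 a? * 𝟙 b?
𝟙-× a? b? with does a? | does b?
... | true  | true  = refl
... | true  | false = refl
... | false | _     = refl

𝟙≤1 : (a? : Dec A) → 𝟙 a? ≤ 1
𝟙≤1 a? with does a?
... | true  = ≤-refl
... | false = z≤n

𝟙-idem : (a? : Dec A) → 𝟙 a? * 𝟙 a? ≡ 𝟙 a?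
𝟙-idem a? with does a?
... | true  = refl
... | false = refl

𝟙-mono : (A → B) → (a? : Dec A) (b? : Dec B) → 𝟙 a? ≤ 𝟙 b?
𝟙-mono A→B a? (yes b) = 𝟙≤1 a?
𝟙-mono A→B (yes a) (no ¬b) = ⊥-elim (¬b (A→B a))
𝟙-mono A→B (no ¬a) (no ¬b) = z≤n

∑-mono-≤ : {f g : Fin n → ℕ} → (∀ i → f i ≤ g i) → sum f ≤ sum g
∑-mono-≤ {zero}  f≤g = z≤n
∑-mono-≤ {suc n} f≤g = +-mono-≤ (f≤g zero) (∑-mono-≤ (f≤g ∘ suc))

∑-const : ∀ n c → ∑[ i < n ] c ≡ n * c
∑-const zero    c = refl
∑-const (suc n) c = cong (c +_) (∑-const n c)

∑-zero : {f : Fin n → ℕ} → (∀ i → f i ≡ 0) → sum f ≡ 0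
∑-zero {n} {f} f≡0 = trans (sum-cong-≗ {n} f≡0) (trans (∑-const n 0) (*-zeroʳ n))

∑-pick : (f : Fin n → ℕ) (j : Fin n) → ∑[ i < n ] (f i * 𝟙 (j ≟ᶠ i)) ≡ f j
∑-pick {suc n} f zero    =
  trans (cong₂ _+_ (*-identityʳ (f zero)) (∑-zero {n} λ i → *-zeroʳ (f (suc i)))) (+-identityʳ (f zero))
∑-pick {suc n} f (suc j) =
  trans (cong (_+ ∑[ i < n ] (f (suc i) * 𝟙 (j ≟ᶠ i))) (*-zeroʳ (f zero))) (∑-pick (f ∘ suc) j)

∑-𝟙-≟ : (j : Fin n) → ∑[ i < n ] 𝟙 (j ≟ᶠ i) ≡ 1
∑-𝟙-≟ {n} j = trans (sum-cong-≗ {n} λ i → sym (*-identityˡ (𝟙 (j ≟ᶠ i)))) (∑-pick (λ _ → 1) j)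

∑-pick-toℕ : ∀ (f : ℕ → ℕ) {d} → d < m → ∑[ i < m ] (f (toℕ i) * 𝟙 (d ≟ toℕ i)) ≡ f d
∑-pick-toℕ {suc m} f {zero}  (s≤s _)   =
  trans (cong₂ _+_ (*-identityʳ (f 0)) (∑-zero {m} λ i → *-zeroʳ (f (suc (toℕ i))))) (+-identityʳ (f 0))
∑-pick-toℕ {suc m} f {suc d} (s≤s d<m) =
  trans (cong (_+ ∑[ i < m ] (f (suc (toℕ i)) * 𝟙 (d ≟ toℕ i))) (*-zeroʳ (f 0))) (∑-pick-toℕ (f ∘ suc) d<m)

∑-group : (g : Fin n → ℕ) (d : Fin n → ℕ) (f : ℕ → ℕ) → (∀ w → d w < m) →
  ∑[ w < n ] (g w * f (d w)) ≡ ∑[ i < m ] (f (toℕ i) * ∑[ w < n ] (g w * 𝟙 (d w ≟ toℕ i)))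
∑-group {n} {m} g d f d<m = begin
  ∑[ w < n ] (g w * f (d w))
    ≡⟨ sum-cong-≗ {n} (λ w → cong (g w *_) (sym (∑-pick-toℕ f (d<m w)))) ⟩
  ∑[ w < n ] (g w * ∑[ i < m ] (f (toℕ i) * 𝟙 (d w ≟ toℕ i)))
    ≡⟨ sum-cong-≗ {n} (λ w → *-distribˡ-sum {m} (g w) λ i → f (toℕ i) * 𝟙 (d w ≟ toℕ i)) ⟩
  ∑[ w < n ] ∑[ i < m ] (g w * (f (toℕ i) * 𝟙 (d w ≟ toℕ i)))
    ≡⟨ ∑-comm {n} {m} (λ w i → g w * (f (toℕ i) * 𝟙 (d w ≟ toℕ i))) ⟩
  ∑[ i < m ] ∑[ w < n ] (g w * (f (toℕ i) * 𝟙 (d w ≟ toℕ i)))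
    ≡⟨ sum-cong-≗ {m} (λ i → sum-cong-≗ {n} λ w → x∙yz≈y∙xz (g w) (f (toℕ i)) _) ⟩
  ∑[ i < m ] ∑[ w < n ] (f (toℕ i) * (g w * 𝟙 (d w ≟ toℕ i)))
    ≡⟨ sum-cong-≗ {m} (λ i → sym (*-distribˡ-sum {n} (f (toℕ i)) λ w → g w * 𝟙 (d w ≟ toℕ i))) ⟩
  ∑[ i < m ] (f (toℕ i) * ∑[ w < n ] (g w * 𝟙 (d w ≟ toℕ i)))
    ∎
  where open ≡-Reasoning

∑-≤-pred : {f : Fin (suc n) → ℕ} (i : Fin (suc n)) → (∀ j → f j ≤ 1) → f i ≡ 0 → sum f ≤ n
∑-≤-pred {n} {f} i f≤1 fi≡0 = begin
  sum f                           ≡⟨ sum-remove f ⟩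
  f i + sum (f ∘ punchIn i)       ≡⟨ cong (_+ sum (f ∘ punchIn i)) fi≡0 ⟩
  sum (f ∘ punchIn i)             ≤⟨ ∑-mono-≤ (f≤1 ∘ punchIn i) ⟩
  ∑[ j < n ] 1                    ≡⟨ trans (∑-const n 1) (*-identityʳ n) ⟩
  n                               ∎
  where open ≤-Reasoning

∑-affine : {c a e : Fin m → ℕ} {μ k ν λ' : ℕ} →
  (∀ i → c i + μ * (a i + e i) ≡ k * e i + ν + λ' * a i) →
  sum c + μ * (sum a + sum e) ≡ k * sum e + m * ν + λ' * sum a
∑-affine {m} {c} {a} {e} {μ} {k} {ν} {λ'} pointwise = begin
  sum c + μ * (sum a + sum e)
    ≡⟨ cong (λ s → sum c + μ * s) (sym (∑-distrib-+ {m} a e)) ⟩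
  sum c + μ * ∑[ i < m ] (a i + e i)
    ≡⟨ cong (sum c +_) (*-distribˡ-sum {m} μ λ i → a i + e i) ⟩
  sum c + ∑[ i < m ] (μ * (a i + e i))
    ≡⟨ sym (∑-distrib-+ {m} c _) ⟩
  ∑[ i < m ] (c i + μ * (a i + e i))
    ≡⟨ sum-cong-≗ {m} pointwise ⟩
  ∑[ i < m ] (k * e i + ν + λ' * a i)
    ≡⟨ ∑-distrib-+ {m} (λ i → k * e i + ν) _ ⟩
  ∑[ i < m ] (k * e i + ν) + ∑[ i < m ] (λ' * a i)
    ≡⟨ cong₂ _+_ (∑-distrib-+ {m} (λ i → k * e i) _) (sym (*-distribˡ-sum {m} λ' a)) ⟩
  ∑[ i < m ] (k * e i) + ∑[ i < m ] ν + λ' * sum a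
    ≡⟨ cong (λ s → s + λ' * sum a) (cong₂ _+_ (sym (*-distribˡ-sum {m} k e)) (∑-const m ν)) ⟩
  k * sum e + m * ν + λ' * sum a
    ∎
  where open ≡-Reasoning

5*n≤n*n+6 : ∀ n → 5 * n ≤ n * n + 6
5*n≤n*n+6 0 = z≤n
5*n≤n*n+6 1 = ≤ᵇ⇒≤ _ _ _
5*n≤n*n+6 2 = ≤-refl
5*n≤n*n+6 3 = ≤-refl
5*n≤n*n+6 4 = ≤ᵇ⇒≤ _ _ _
5*n≤n*n+6 n@(suc (suc (suc (suc (suc m))))) = ≤-trans (*-monoˡ-≤ n (m≤m+n 5 m)) (m≤m+n (n * n) 6)

-- Summing (t − 2)(t − 3) ≥ 0, which is 2 at t = 4, arranged without subtraction.
∑-quadratic-bound : (t : Fin n → ℕ) {x y : Fin n} → x ≢ y → t x ≡ 4 → t y ≡ 4 →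
  5 * sum t + 4 ≤ ∑[ w < n ] (t w * t w) + n * 6
∑-quadratic-bound {n} t {x} {y} x≢y tx≡4 ty≡4 = begin
  5 * sum t + 2 * (1 + 1)
    ≡⟨ cong₂ (λ a b → 5 * sum t + 2 * (a + b)) (∑-𝟙-≟ x) (∑-𝟙-≟ y) ⟨
  5 * sum t + 2 * (∑[ w < n ] 𝟙 (x ≟ᶠ w) + ∑[ w < n ] 𝟙 (y ≟ᶠ w))
    ≡⟨ cong₂ (λ a b → a + 2 * b) (*-distribˡ-sum {n} 5 t)
             (sym (∑-distrib-+ {n} (λ w → 𝟙 (x ≟ᶠ w)) _)) ⟩
  ∑[ w < n ] (5 * t w) + 2 * ∑[ w < n ] (𝟙 (x ≟ᶠ w) + 𝟙 (y ≟ᶠ w))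
    ≡⟨ cong (∑[ w < n ] (5 * t w) +_) (*-distribˡ-sum {n} 2 λ w → 𝟙 (x ≟ᶠ w) + 𝟙 (y ≟ᶠ w)) ⟩
  ∑[ w < n ] (5 * t w) + ∑[ w < n ] (2 * (𝟙 (x ≟ᶠ w) + 𝟙 (y ≟ᶠ w)))
    ≡⟨ ∑-distrib-+ {n} (λ w → 5 * t w) _ ⟨
  ∑[ w < n ] (5 * t w + 2 * (𝟙 (x ≟ᶠ w) + 𝟙 (y ≟ᶠ w)))
    ≤⟨ ∑-mono-≤ pointwise ⟩
  ∑[ w < n ] (t w * t w + 6)
    ≡⟨ trans (∑-distrib-+ {n} (λ w → t w * t w) _) (cong (∑[ w < n ] (t w * t w) +_) (∑-const n 6)) ⟩
  ∑[ w < n ] (t w * t w) + n * 6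
    ∎
  where
  open ≤-Reasoning
  pointwise : ∀ w → 5 * t w + 2 * (𝟙 (x ≟ᶠ w) + 𝟙 (y ≟ᶠ w)) ≤ t w * t w + 6
  pointwise w with x ≟ᶠ w | y ≟ᶠ w
  ... | yes refl | yes refl = ⊥-elim (x≢y refl)
  ... | yes refl | no _     rewrite tx≡4 = ≤-refl
  ... | no _     | yes refl rewrite ty≡4 = ≤-refl
  ... | no _     | no _     = subst (_≤ t w * t w + 6) (sym (+-identityʳ (5 * t w))) (5*n≤n*n+6 (t w))

length-filter-tabulate : ∀ {p} {P : Pred A p} (P? : Decidable P) (f : Fin n → A) →
  length (filter P? (tabulate f)) ≡ ∑[ i < n ] 𝟙 (P? (f i))
length-filter-tabulate {n = zero}  P? f = refl
length-filter-tabulate {n = suc n} P? f with does (P? (f zero))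
... | true  = cong suc (length-filter-tabulate P? (f ∘ suc))
... | false = length-filter-tabulate P? (f ∘ suc)

count≡∑ : {P : Pred (Fin n) 0ℓ} (P? : Decidable P) → count P P? ≡ ∑[ i < n ] 𝟙 (P? i)
count≡∑ P? = length-filter-tabulate P? id

count-none : {P : Pred (Fin n) 0ℓ} (P? : Decidable P) → (∀ i → ¬ P i) → count P P? ≡ 0
count-none P? ¬P = cong length (filter-none P? (tabulate⁺ ¬P))

count-mono : {P Q : Pred (Fin n) 0ℓ} (P? : Decidable P) (Q? : Decidable Q) →
  (∀ i → P i → Q i) → count P P? ≤ count Q Q?
count-mono P? Q? P⇒Q = subst₂ _≤_ (sym (count≡∑ P?)) (sym (count≡∑ Q?))
  (∑-mono-≤ λ i → 𝟙-mono (P⇒Q i) (P? i) (Q? i))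

outside : (S : Fin m → Fin n) → Fin n → ℕ
outside S w = 𝟙 (¬? (any? λ j → S j ≟ᶠ w))

module _ {S : Fin m → Fin n} (S-injective : Injective _≡_ _≡_ S) where

  𝟙-≟-injective : ∀ i j → 𝟙 (S i ≟ᶠ S j) ≡ 𝟙 (j ≟ᶠ i)
  𝟙-≟-injective i j =
    𝟙-cong (mk⇔ (λ Si≡Sj → sym (S-injective Si≡Sj)) (λ j≡i → cong S (sym j≡i)))
           (S i ≟ᶠ S j) (j ≟ᶠ i)

  ∑-𝟙-≟-injective : ∀ j → ∑[ i < m ] 𝟙 (S i ≟ᶠ S j) ≡ 1
  ∑-𝟙-≟-injective j = trans (sum-cong-≗ {m} λ i → 𝟙-≟-injective i j) (∑-𝟙-≟ j)

  outside+∑-𝟙-≟ : ∀ w → outside S w + ∑[ i < m ] 𝟙 (S i ≟ᶠ w) ≡ 1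
  outside+∑-𝟙-≟ w with any? (λ j → S j ≟ᶠ w)
  ... | yes (j , refl) = ∑-𝟙-≟-injective j
  ... | no w∉S         = cong suc (∑-zero {m} λ i → 𝟙-no (S i ≟ᶠ w) λ Si≡w → w∉S (i , Si≡w))

  ∑-split-outside : (g : Fin n → ℕ) → sum g ≡ ∑[ w < n ] (g w * outside S w) + ∑[ i < m ] g (S i)
  ∑-split-outside g = begin
    ∑[ w < n ] g w
      ≡⟨ sum-cong-≗ {n} (λ w → sym (trans (cong (g w *_) (outside+∑-𝟙-≟ w)) (*-identityʳ (g w)))) ⟩
    ∑[ w < n ] (g w * (outside S w + ∑[ i < m ] 𝟙 (S i ≟ᶠ w)))
      ≡⟨ sum-cong-≗ {n} (λ w → trans (*-distribˡ-+ (g w) _ _)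
                                     (cong (g w * outside S w +_) (*-distribˡ-sum {m} (g w) _))) ⟩
    ∑[ w < n ] (g w * outside S w + ∑[ i < m ] (g w * 𝟙 (S i ≟ᶠ w)))
      ≡⟨ ∑-distrib-+ {n} (λ w → g w * outside S w) _ ⟩
    ∑[ w < n ] (g w * outside S w) + ∑[ w < n ] ∑[ i < m ] (g w * 𝟙 (S i ≟ᶠ w))
      ≡⟨ cong (∑[ w < n ] (g w * outside S w) +_) (∑-comm {n} {m} λ w i → g w * 𝟙 (S i ≟ᶠ w)) ⟩
    ∑[ w < n ] (g w * outside S w) + ∑[ i < m ] ∑[ w < n ] (g w * 𝟙 (S i ≟ᶠ w))
      ≡⟨ cong (∑[ w < n ] (g w * outside S w) +_) (sum-cong-≗ {m} λ i → ∑-pick g (S i)) ⟩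
    ∑[ w < n ] (g w * outside S w) + ∑[ i < m ] g (S i)
      ∎
    where open ≡-Reasoning

∷-injective : {S : Fin m → Fin n} {v : Fin n} →
  Injective _≡_ _≡_ S → (∀ i → S i ≢ v) → Injective _≡_ _≡_ (v Vector.∷ S)
∷-injective S-inj v∉S {zero}  {zero}  _    = refl
∷-injective S-inj v∉S {zero}  {suc j} v≡Sj = ⊥-elim (v∉S j (sym v≡Sj))
∷-injective S-inj v∉S {suc i} {zero}  Si≡v = ⊥-elim (v∉S i Si≡v)
∷-injective S-inj v∉S {suc i} {suc j} Si≡Sj = cong suc (S-inj Si≡Sj)

-- Graphs

module _ {n : ℕ} (G : Graph n) where
  open Graph G renaming (sym to Adj-sym)

  adj : Fin n → Fin n → ℕ
  adj u v = 𝟙 (adj? u v)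

  adj-sym : ∀ u v → adj u v ≡ adj v u
  adj-sym u v = 𝟙-cong (mk⇔ Adj-sym Adj-sym) (adj? u v) (adj? v u)

  adj-irrefl : ∀ u → adj u u ≡ 0
  adj-irrefl u = 𝟙-no (adj? u u) irrefl

  degIn : (Fin m → Fin n) → Fin n → ℕ
  degIn {m} S w = ∑[ i < m ] adj w (S i)

  degIn-sym : (S : Fin m → Fin n) (v : Fin n) → ∑[ i < m ] adj (S i) v ≡ degIn S v
  degIn-sym {m} S v = sum-cong-≗ {m} λ i → adj-sym (S i) v

  nbrsInK≡degIn : (S : Fin m → Fin n) (w : Fin n) → nbrsInK G S w ≡ degIn S w
  nbrsInK≡degIn S w = count≡∑ λ i → adj? w (S i)

  degIn≤ : (S : Fin m → Fin n) (w : Fin n) → degIn S w ≤ m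
  degIn≤ {m} S w =
    subst (degIn S w ≤_) (trans (∑-const m 1) (*-identityʳ m)) (∑-mono-≤ λ i → 𝟙≤1 (adj? w (S i)))

  nbrsIn-Xi : (v : Fin n) (S : Fin m → Fin n) (i : ℕ) →
    nbrsIn G v (Xi G S i) (Xi? G S i) ≡ ∑[ w < n ] (adj v w * outside S w * 𝟙 (degIn S w ≟ i))
  nbrsIn-Xi v S i = trans (count≡∑ λ w → adj? v w ×-dec Xi? G S i w) (sum-cong-≗ {n} λ w → begin
    𝟙 (adj? v w ×-dec Xi? G S i w)
      ≡⟨ 𝟙-× (adj? v w) (Xi? G S i w) ⟩
    adj v w * 𝟙 (Xi? G S i w)
      ≡⟨ cong (adj v w *_) (𝟙-× (¬? (any? λ j → S j ≟ᶠ w)) (nbrsInK G S w ≟ i)) ⟩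
    adj v w * (outside S w * 𝟙 (nbrsInK G S w ≟ i))
      ≡⟨ *-assoc (adj v w) (outside S w) (𝟙 (nbrsInK G S w ≟ i)) ⟨
    adj v w * outside S w * 𝟙 (nbrsInK G S w ≟ i)
      ≡⟨ cong (λ d → adj v w * outside S w * 𝟙 (d ≟ i)) (nbrsInK≡degIn S w) ⟩
    adj v w * outside S w * 𝟙 (degIn S w ≟ i)
      ∎)
    where open ≡-Reasoning

  degree≡∑ : ∀ v → degree G v ≡ ∑[ w < n ] adj v w
  degree≡∑ v = count≡∑ (adj? v)

  commonNbrs≡∑ : ∀ u v → commonNbrs G u v ≡ ∑[ w < n ] (adj u w * adj v w)
  commonNbrs≡∑ u v =
    trans (count≡∑ λ w → adj? u w ×-dec adj? v w) (sum-cong-≗ {n} λ w → 𝟙-× (adj? u w) (adj? v w))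

  commonNbrs-self : ∀ u → commonNbrs G u u ≡ degree G u
  commonNbrs-self u =
    trans (commonNbrs≡∑ u u) (trans (sum-cong-≗ {n} λ w → 𝟙-idem (adj? u w)) (sym (degree≡∑ u)))

  ∑-degIn : (S : Fin m → Fin n) → ∑[ w < n ] degIn S w ≡ ∑[ i < m ] degree G (S i)
  ∑-degIn {m} S = begin
    ∑[ w < n ] ∑[ i < m ] adj w (S i)
      ≡⟨ ∑-comm {n} {m} (λ w i → adj w (S i)) ⟩
    ∑[ i < m ] ∑[ w < n ] adj w (S i)
      ≡⟨ sum-cong-≗ {m} (λ i → trans (degIn-sym id (S i)) (sym (degree≡∑ (S i)))) ⟩
    ∑[ i < m ] degree G (S i)
      ∎
    where open ≡-Reasoning

  ∑-adj*degIn : (v : Fin n) (S : Fin m → Fin n) →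
    ∑[ w < n ] (adj v w * degIn S w) ≡ ∑[ i < m ] commonNbrs G v (S i)
  ∑-adj*degIn {m} v S = begin
    ∑[ w < n ] (adj v w * degIn S w)
      ≡⟨ sum-cong-≗ {n} (λ w → *-distribˡ-sum {m} (adj v w) λ i → adj w (S i)) ⟩
    ∑[ w < n ] ∑[ i < m ] (adj v w * adj w (S i))
      ≡⟨ ∑-comm {n} {m} (λ w i → adj v w * adj w (S i)) ⟩
    ∑[ i < m ] ∑[ w < n ] (adj v w * adj w (S i))
      ≡⟨ sum-cong-≗ {m} (λ i → trans (sum-cong-≗ {n} λ w → cong (adj v w *_) (adj-sym w (S i)))
                                     (sym (commonNbrs≡∑ v (S i)))) ⟩
    ∑[ i < m ] commonNbrs G v (S i)
      ∎
    where open ≡-Reasoning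

  ∑-degIn*degIn : {l : ℕ} (T : Fin l → Fin n) (S : Fin m → Fin n) →
    ∑[ w < n ] (degIn T w * degIn S w) ≡ ∑[ j < l ] ∑[ i < m ] commonNbrs G (T j) (S i)
  ∑-degIn*degIn {m} {l} T S = begin
    ∑[ w < n ] (degIn T w * degIn S w)
      ≡⟨ sum-cong-≗ {n} (λ w → *-distribʳ-sum {l} (degIn S w) λ j → adj w (T j)) ⟩
    ∑[ w < n ] ∑[ j < l ] (adj w (T j) * degIn S w)
      ≡⟨ ∑-comm {n} {l} (λ w j → adj w (T j) * degIn S w) ⟩
    ∑[ j < l ] ∑[ w < n ] (adj w (T j) * degIn S w)
      ≡⟨ sum-cong-≗ {l} (λ j → trans (sum-cong-≗ {n} λ w → cong (_* degIn S w) (adj-sym w (T j)))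
                                     (∑-adj*degIn (T j) S)) ⟩
    ∑[ j < l ] ∑[ i < m ] commonNbrs G (T j) (S i)
      ∎
    where open ≡-Reasoning

  suc-degIn-clique : {S : Fin m → Fin n} → IsClique G S → ∀ i → suc (degIn S (S i)) ≡ m
  suc-degIn-clique {m} {S} (S-injective , S-adjacent) i = begin
    suc (degIn S (S i))
      ≡⟨ +-comm 1 _ ⟩
    degIn S (S i) + 1
      ≡⟨ cong (degIn S (S i) +_) (sym (∑-𝟙-≟ i)) ⟩
    degIn S (S i) + ∑[ j < m ] 𝟙 (i ≟ᶠ j)
      ≡⟨ sym (∑-distrib-+ {m} (λ j → adj (S i) (S j)) _) ⟩
    ∑[ j < m ] (adj (S i) (S j) + 𝟙 (i ≟ᶠ j))
      ≡⟨ sum-cong-≗ {m} adj+𝟙≡1 ⟩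
    ∑[ j < m ] 1
      ≡⟨ trans (∑-const m 1) (*-identityʳ m) ⟩
    m ∎
    where
    open ≡-Reasoning
    adj+𝟙≡1 : ∀ j → adj (S i) (S j) + 𝟙 (i ≟ᶠ j) ≡ 1
    adj+𝟙≡1 j with i ≟ᶠ j
    ... | yes refl = cong (_+ 1) (adj-irrefl (S i))
    ... | no i≢j   = trans (+-identityʳ _) (𝟙-yes (adj? (S i) (S j)) (S-adjacent i j i≢j))

  degIn≡⇒adjacent : (S : Fin m → Fin n) (w : Fin n) → degIn S w ≡ m → ∀ i → Adj w (S i)
  degIn≡⇒adjacent {suc m} S w deg≡ i with adj? w (S i)
  ... | yes w~Si = w~Si
  ... | no  w≁Si = ⊥-elim (<-irrefl refl (subst (_≤ m) deg≡
                     (∑-≤-pred i (λ j → 𝟙≤1 (adj? w (S j))) (𝟙-no (adj? w (S i)) w≁Si))))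

  ∷-clique : {S : Fin m → Fin n} {v : Fin n} →
    IsClique G S → (∀ i → S i ≢ v) → (∀ i → Adj v (S i)) → IsClique G (v Vector.∷ S)
  ∷-clique (S-injective , S-adjacent) v∉S v~S = ∷-injective S-injective v∉S , adjacent
    where
    adjacent : ∀ i j → i ≢ j → Adj _ _
    adjacent zero    zero    0≢0 = ⊥-elim (0≢0 refl)
    adjacent zero    (suc j) _   = v~S j
    adjacent (suc i) zero    _   = Adj-sym (v~S i)
    adjacent (suc i) (suc j) i≢j = S-adjacent i j (λ i≡j → i≢j (cong suc i≡j))

  Xi-maximal-empty : {S : Fin m → Fin n} → IsClique G S →
    ¬ (∃[ L ] (IsClique G {suc m} L × _⊆ᶜ_ G S L)) → ∀ w → ¬ Xi G S m w
  Xi-maximal-empty {m} {S} S-clique S-maximal w (w∉S , deg≡m) =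
    S-maximal (w Vector.∷ S , extended , λ i → suc i , refl)
    where
    extended : IsClique G (w Vector.∷ S)
    extended = ∷-clique S-clique (λ i Si≡w → w∉S (i , Si≡w))
                 (degIn≡⇒adjacent S w (trans (sym (nbrsInK≡degIn S w)) deg≡m))

-- Strongly regular graphs

module _ {n k λ' μ : ℕ} {G : Graph n} (srg : IsSRG G k λ' μ) where
  open Graph G
  open IsSRG srg

  -- The cases u = v, u ~ v and u ≁ v of the parameter conditions as one identity without subtraction.
  commonNbrs-srg : ∀ u v →
    commonNbrs G u v + μ * (adj G u v + 𝟙 (u ≟ᶠ v)) ≡ k * 𝟙 (u ≟ᶠ v) + μ + λ' * adj G u v
  commonNbrs-srg u v with u ≟ᶠ v
  ... | yes refl = begin
    commonNbrs G u u + μ * (adj G u u + 1)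
      ≡⟨ cong₂ (λ c a → c + μ * (a + 1)) (trans (commonNbrs-self G u) (regular u)) (adj-irrefl G u) ⟩
    k + μ * (0 + 1)
      ≡⟨ arithmetic k λ' μ ⟩
    k * 1 + μ + λ' * 0
      ≡⟨ cong (λ a → k * 1 + μ + λ' * a) (adj-irrefl G u) ⟨
    k * 1 + μ + λ' * adj G u u
      ∎
    where
    open ≡-Reasoning
    arithmetic : ∀ k λ' μ → k + μ * (0 + 1) ≡ k * 1 + μ + λ' * 0
    arithmetic = solve-∀
  ... | no u≢v with adj? u v
  ...   | yes u~v = trans (cong (_+ μ * 1) (adjacent u v u≢v u~v)) (arithmetic k λ' μ)
    where
    arithmetic : ∀ k λ' μ → λ' + μ * (1 + 0) ≡ k * 0 + μ + λ' * 1
    arithmetic = solve-∀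
  ...   | no  u≁v = trans (cong (_+ μ * 0) (nonadjacent u v u≢v u≁v)) (arithmetic k λ' μ)
    where
    arithmetic : ∀ k λ' μ → μ + μ * (0 + 0) ≡ k * 0 + μ + λ' * 0
    arithmetic = solve-∀

  ∑-commonNbrs : {l : ℕ} (u : Fin n) (T : Fin l → Fin n) →
    ∑[ j < l ] commonNbrs G u (T j) + μ * (degIn G T u + ∑[ j < l ] 𝟙 (u ≟ᶠ T j))
      ≡ k * ∑[ j < l ] 𝟙 (u ≟ᶠ T j) + l * μ + λ' * degIn G T u
  ∑-commonNbrs u T = ∑-affine {μ = μ} {k} {μ} {λ'} λ j → commonNbrs-srg u (T j)

  ∑∑-commonNbrs : {l : ℕ} (S : Fin m → Fin n) (T : Fin l → Fin n) →
    ∑[ i < m ] ∑[ j < l ] commonNbrs G (S i) (T j)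
      + μ * (∑[ i < m ] degIn G T (S i) + ∑[ i < m ] ∑[ j < l ] 𝟙 (S i ≟ᶠ T j))
      ≡ k * ∑[ i < m ] ∑[ j < l ] 𝟙 (S i ≟ᶠ T j) + m * (l * μ) + λ' * ∑[ i < m ] degIn G T (S i)
  ∑∑-commonNbrs {l = l} S T = ∑-affine {μ = μ} {k} {l * μ} {λ'} λ i → ∑-commonNbrs (S i) T

-- The (95,40,12,20) case

module _ {X : Graph 95} (srg : IsSRG X 40 12 20) {K : Fin 4 → Fin 95} (K-clique : IsClique X K) where
  open Graph X using (Adj; irrefl)
  open IsSRG srg using (regular)

  K-injective : Injective _≡_ _≡_ K
  K-injective = proj₁ K-clique

  degIn-K : ∀ i → degIn X K (K i) ≡ 3
  degIn-K i = suc-injective (suc-degIn-clique X K-clique i)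

  module _ {x : Fin 95} (x∈X₃ : Xi X K 3 x) where

    x∉K : ∀ i → K i ≢ x
    x∉K i Ki≡x = proj₁ x∈X₃ (i , Ki≡x)

    degIn-x : degIn X K x ≡ 3
    degIn-x = trans (sym (nbrsInK≡degIn X K x)) (proj₂ x∈X₃)

    ∑-commonNbrs-X₃ : ∑[ i < 4 ] commonNbrs X x (K i) ≡ 56
    ∑-commonNbrs-X₃ = cancel degIn-x (∑-zero {4} λ j → 𝟙-no (x ≟ᶠ K j) λ x≡Kj → x∉K j (sym x≡Kj))
                        (∑-commonNbrs srg x K)
      where
      cancel : ∀ {c d e} → d ≡ 3 → e ≡ 0 → c + 20 * (d + e) ≡ 40 * e + 4 * 20 + 12 * d → c ≡ 56
      cancel refl refl = +-cancelʳ-≡ 60 _ 56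

    ∑-adj-outside : ∑[ w < 95 ] (adj X x w * outside K w) ≡ 37
    ∑-adj-outside = +-cancelʳ-≡ 3 _ 37 (begin
      ∑[ w < 95 ] (adj X x w * outside K w) + 3
        ≡⟨ cong (∑[ w < 95 ] (adj X x w * outside K w) +_) degIn-x ⟨
      ∑[ w < 95 ] (adj X x w * outside K w) + degIn X K x
        ≡⟨ ∑-split-outside K-injective (adj X x) ⟨
      ∑[ w < 95 ] adj X x w
        ≡⟨ trans (sym (degree≡∑ X x)) (regular x) ⟩
      40 ∎)
      where open ≡-Reasoning

    ∑-adj-outside-degIn : ∑[ w < 95 ] (adj X x w * outside K w * degIn X K w) ≡ 47
    ∑-adj-outside-degIn = begin
      ∑[ w < 95 ] (adj X x w * outside K w * degIn X K w)
        ≡⟨ sum-cong-≗ {95} (λ w → xy∙z≈xz∙y (adj X x w) (outside K w) (degIn X K w)) ⟩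
      ∑[ w < 95 ] (adj X x w * degIn X K w * outside K w)
        ≡⟨ +-cancelʳ-≡ 9 _ 47 (begin
             ∑[ w < 95 ] (adj X x w * degIn X K w * outside K w) + 9
               ≡⟨ cong (∑[ w < 95 ] (adj X x w * degIn X K w * outside K w) +_) ∑-adj-K*degIn≡9 ⟨
             ∑[ w < 95 ] (adj X x w * degIn X K w * outside K w) + ∑[ i < 4 ] (adj X x (K i) * degIn X K (K i))
               ≡⟨ ∑-split-outside K-injective (λ w → adj X x w * degIn X K w) ⟨
             ∑[ w < 95 ] (adj X x w * degIn X K w)
               ≡⟨ trans (∑-adj*degIn X x K) ∑-commonNbrs-X₃ ⟩
             56 ∎) ⟩
      47 ∎
      where
      open ≡-Reasoning
      ∑-adj-K*degIn≡9 : ∑[ i < 4 ] (adj X x (K i) * degIn X K (K i)) ≡ 9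
      ∑-adj-K*degIn≡9 = begin
        ∑[ i < 4 ] (adj X x (K i) * degIn X K (K i))
          ≡⟨ sum-cong-≗ {4} (λ i → cong (adj X x (K i) *_) (degIn-K i)) ⟩
        ∑[ i < 4 ] (adj X x (K i) * 3)
          ≡⟨ *-distribʳ-sum {4} 3 (λ i → adj X x (K i)) ⟨
        degIn X K x * 3
          ≡⟨ cong (_* 3) degIn-x ⟩
        9 ∎

    N : ℕ → ℕ
    N i = nbrsIn X x (Xi X K i) (Xi? X K i)

    ∑-adj-outside-by-degIn : (f : ℕ → ℕ) →
      ∑[ w < 95 ] (adj X x w * outside K w * f (degIn X K w)) ≡ ∑[ i < 5 ] (f (toℕ i) * N (toℕ i))
    ∑-adj-outside-by-degIn f =
      trans (∑-group (λ w → adj X x w * outside K w) (degIn X K) f (λ w → s≤s (degIn≤ X K w)))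
            (sum-cong-≗ {5} λ i → cong (f (toℕ i) *_) (sym (nbrsIn-Xi X x K (toℕ i))))

    ∑-N≡37 : ∑[ i < 5 ] (1 * N (toℕ i)) ≡ 37
    ∑-N≡37 = trans (sym (∑-adj-outside-by-degIn λ _ → 1))
                   (trans (sum-cong-≗ {95} λ w → *-identityʳ (adj X x w * outside K w)) ∑-adj-outside)

    ∑-iN≡47 : ∑[ i < 5 ] (toℕ i * N (toℕ i)) ≡ 47
    ∑-iN≡47 = trans (sym (∑-adj-outside-by-degIn id)) ∑-adj-outside-degIn

  X₃-independent : ∀ {x y} → Xi X K 3 x → Xi X K 3 y → ¬ Adj x y
  X₃-independent {x} {y} x∈X₃ y∈X₃ x~y = <⇒≱ (n≤1+n 1203) (begin
    1204                             ≡⟨ cong (λ s → 5 * s + 4) Σt≡240 ⟨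
    5 * sum t + 4                    ≤⟨ ∑-quadratic-bound t x≢y tx≡4 ty≡4 ⟩
    ∑[ w < 95 ] (t w * t w) + 95 * 6 ≡⟨ cong (_+ 95 * 6) Σt²≡632 ⟩
    1202                             ∎)
    where
    open ≤-Reasoning
    open Graph X using (adj?) renaming (sym to Adj-sym)
    x≢y : x ≢ y
    x≢y refl = irrefl x~y
    S : Fin 6 → Fin 95
    S = x Vector.∷ y Vector.∷ K
    S-injective : Injective _≡_ _≡_ S
    S-injective = ∷-injective (∷-injective K-injective (x∉K y∈X₃)) λ where
      zero    y≡x  → x≢y (sym y≡x)
      (suc i) Ki≡x → x∉K x∈X₃ i Ki≡x
    t : Fin 95 → ℕ
    t = degIn X S
    tx≡4 : t x ≡ 4
    tx≡4 = cong₂ _+_ (adj-irrefl X x) (cong₂ _+_ (𝟙-yes (adj? x y) x~y) (degIn-x x∈X₃))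
    ty≡4 : t y ≡ 4
    ty≡4 = cong₂ _+_ (𝟙-yes (adj? y x) (Adj-sym x~y)) (cong₂ _+_ (adj-irrefl X y) (degIn-x y∈X₃))
    ∑tK≡18 : ∑[ i < 4 ] t (K i) ≡ 18
    ∑tK≡18 = begin-equality
      ∑[ i < 4 ] (adj X (K i) x + (adj X (K i) y + degIn X K (K i)))
        ≡⟨ ∑-distrib-+ {4} (λ i → adj X (K i) x) (λ i → adj X (K i) y + degIn X K (K i)) ⟩
      ∑[ i < 4 ] adj X (K i) x + ∑[ i < 4 ] (adj X (K i) y + degIn X K (K i))
        ≡⟨ cong (∑[ i < 4 ] adj X (K i) x +_)
                (∑-distrib-+ {4} (λ i → adj X (K i) y) (λ i → degIn X K (K i))) ⟩
      ∑[ i < 4 ] adj X (K i) x + (∑[ i < 4 ] adj X (K i) y + ∑[ i < 4 ] degIn X K (K i))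
        ≡⟨ cong₂ _+_ (trans (degIn-sym X K x) (degIn-x x∈X₃))
                     (cong₂ _+_ (trans (degIn-sym X K y) (degIn-x y∈X₃)) (sum-cong-≗ {4} degIn-K)) ⟩
      18 ∎
    Σt≡240 : sum t ≡ 240
    Σt≡240 = trans (∑-degIn X S) (sum-cong-≗ {6} (regular ∘ S))
    Σt²≡632 : ∑[ w < 95 ] (t w * t w) ≡ 632
    Σt²≡632 = trans (∑-degIn*degIn X S S)
      (cancel (cong₂ _+_ tx≡4 (cong₂ _+_ ty≡4 ∑tK≡18))
              (trans (∑-comm {6} {6} λ i j → 𝟙 (S i ≟ᶠ S j))
                     (sum-cong-≗ {6} (∑-𝟙-≟-injective S-injective)))
              (∑∑-commonNbrs srg S S))
      where
      cancel : ∀ {c d e} → e ≡ 26 → d ≡ 6 → c + 20 * (e + d) ≡ 40 * d + 6 * (6 * 20) + 12 * e → c ≡ 632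
      cancel refl refl = +-cancelʳ-≡ 640 _ 632

-- The two sums over i < 5 as they unfold.
solve-counts : ∀ {n₀ n₁ n₂ n₃ n₄} → n₀ ≡ 0 → n₃ ≡ 0 → n₄ ≡ 0 →
  1 * n₀ + (1 * n₁ + (1 * n₂ + (1 * n₃ + (1 * n₄ + 0)))) ≡ 37 →
  0 * n₀ + (1 * n₁ + (2 * n₂ + (3 * n₃ + (4 * n₄ + 0)))) ≡ 47 →
  n₁ ≡ 27 × n₂ ≡ 10
solve-counts {n₁ = p} {q} refl refl refl e₁ e₂ = p≡27 , q≡10
  where
  open ≡-Reasoning
  p+q≡37 : p + q ≡ 37
  p+q≡37 = trans (shape p q) e₁
    where
    shape : ∀ p q → p + q ≡ 1 * 0 + (1 * p + (1 * q + (1 * 0 + (1 * 0 + 0))))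
    shape = solve-∀
  q≡10 : q ≡ 10
  q≡10 = +-cancelˡ-≡ 37 q 10 (begin
    37 + q                                                  ≡⟨ cong (_+ q) p+q≡37 ⟨
    p + q + q                                               ≡⟨ shape p q ⟩
    0 * 0 + (1 * p + (2 * q + (3 * 0 + (4 * 0 + 0))))       ≡⟨ e₂ ⟩
    47                                                      ∎)
    where
    shape : ∀ p q → p + q + q ≡ 0 * 0 + (1 * p + (2 * q + (3 * 0 + (4 * 0 + 0))))
    shape = solve-∀
  p≡27 : p ≡ 27
  p≡27 = +-cancelʳ-≡ 10 p 27 (trans (cong (p +_) (sym q≡10)) p+q≡37)

lemma16 : (X : Graph 95) → IsSRG X 40 12 20 →
    (K : Fin 4 → Fin 95) → IsClique X K →
    ¬ (∃[ L ] (IsClique X {5} L × _⊆ᶜ_ X K L)) →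
    count (Xi X K 0) (Xi? X K 0) ≡ 0 →
    count (Xi X K 1) (Xi? X K 1) ≡ 37 →
    count (Xi X K 2) (Xi? X K 2) ≡ 51 →
    count (Xi X K 3) (Xi? X K 3) ≡ 3 →
    ∀ x → Xi X K 3 x →
    (nbrsIn X x (Xi X K 1) (Xi? X K 1) ≡ 27) × (nbrsIn X x (Xi X K 2) (Xi? X K 2) ≡ 10)
lemma16 X srg K K-clique K-maximal X₀-empty _ _ _ x x∈X₃ =
  solve-counts N₀≡0 N₃≡0 N₄≡0 (∑-N≡37 srg K-clique x∈X₃) (∑-iN≡47 srg K-clique x∈X₃)
  where
  open Graph X using (adj?)
  N₀≡0 : nbrsIn X x (Xi X K 0) (Xi? X K 0) ≡ 0
  N₀≡0 = n≤0⇒n≡0 (≤-trans (count-mono (λ w → adj? x w ×-dec Xi? X K 0 w) (Xi? X K 0) λ _ → proj₂)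
                          (≤-reflexive X₀-empty))
  N₃≡0 : nbrsIn X x (Xi X K 3) (Xi? X K 3) ≡ 0
  N₃≡0 = count-none (λ w → adj? x w ×-dec Xi? X K 3 w)
           λ w (x~w , w∈X₃) → X₃-independent srg K-clique x∈X₃ w∈X₃ x~w
  N₄≡0 : nbrsIn X x (Xi X K 4) (Xi? X K 4) ≡ 0
  N₄≡0 = count-none (λ w → adj? x w ×-dec Xi? X K 4 w)
           λ w (_ , w∈X₄) → Xi-maximal-empty X K-clique K-maximal w w∈X₄
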